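{- Let $G=(V,E)$ be a connected bipartite graph of order $n=r+s\ge 4$ with stable sets $U,W$ such that $V=U\cup W$ and $3\le |U|=r\le s=|W|$. Suppose $\lambda(\overline{G})=\lambda(G)+1$ and $U$ is an LD-code of $G$. Let $H$ be a subgraph of the $U$-associated graph $G^U$ induced by a set of edges containing exactly two edges with label $u$ for each $u\in U$. Then every connected component of $H$ is a cactus.
   Context: $\overline{G}$ denotes the complement of $G$. A set $S\subseteq V$ is a locating-dominating set (LD-set) of $G$ if every vertex of $V\setminus S$ has a neighbor in $S$ and for any two distinct $u,v\in V\setminus S$, $N_G(u)\cap S\neq N_G(v)\cap S$. $\lambda(G)$ is the minimum cardinality of an LD-set; an LD-code is an LD-set of cardinality $\lambda(G)$. For an LD-set $S$, the $S$-associated graph $G^S$: take a new vertex $z\notin V$ with $N_G(z)=\emptyset$; $G^S$ has vertex set $(V\setminus S)\cup\{z\}$, $x,y$ are adjacent iff $|(N_G(x)\cap S)\bigtriangleup(N_G(y)\cap S)|=1$, and the label of edge $xy$ is the unique element of that symmetric difference. A cactus is a connected graph all of whose blocks (maximal connected subgraphs without cut vertices) are cycles or edges; equivalently, a connected graph in which no edge lies on two distinct cycles. -}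

module Defs where

open import Data.Nat using (ℕ; zero; suc; _+_; _≤_)
open import Data.Fin using (Fin; zero; suc)
open import Data.Fin.Subset using (Subset; _∈_; _∉_; ∣_∣; ∁)
open import Data.Maybe using (Maybe; just; nothing)
open import Data.Product using (Σ; ∃; _×_; _,_)
open import Data.Sum using (_⊎_)
open import Data.Empty using (⊥)
open import Data.Unit using (⊤)
open import Relation.Nullary using (¬_; Dec)
open import Relation.Binary.PropositionalEquality using (_≡_; _≢_)

record SimpleGraph (n : ℕ) : Set₁ where
  field
    Adj    : Fin n → Fin n → Set
    sym    : ∀ {x y} → Adj x y → Adj y x
    irrefl : ∀ {x} → ¬ Adj x x
    dec    : ∀ x y → Dec (Adj x y)
open SimpleGraph public

complement : ∀ {n} → SimpleGraph n → SimpleGraph n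
complement G = record
  { Adj    = λ x y → x ≢ y × ¬ Adj G x y
  ; sym    = λ { (x≢y , ¬a) → (λ e → x≢y (symm e)) , (λ a → ¬a (sym G a)) }
  ; irrefl = λ { (x≢x , _) → x≢x reflexive }
  ; dec    = λ x y → decC x y
  }
  where
    open import Relation.Binary.PropositionalEquality using () renaming (sym to symm; refl to reflexive)
    open import Relation.Nullary using (yes; no)
    open import Relation.Nullary.Decidable using (_×-dec_; ¬?)
    open import Data.Fin using (_≟_)
    decC : ∀ x y → Dec (x ≢ y × ¬ Adj G x y)
    decC x y = ¬? (x ≟ y) ×-dec ¬? (dec G x y)

SameTrace : ∀ {n} → SimpleGraph n → Subset n → Fin n → Fin n → Set
SameTrace G S u v = ∀ s → s ∈ S → (Adj G u s → Adj G v s) × (Adj G v s → Adj G u s)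

IsLDSet : ∀ {n} → SimpleGraph n → Subset n → Set
IsLDSet G S =
  (∀ v → v ∉ S → ∃ λ s → s ∈ S × Adj G v s) ×
  (∀ u v → u ∉ S → v ∉ S → u ≢ v → ¬ SameTrace G S u v)

IsLambda : ∀ {n} → SimpleGraph n → ℕ → Set
IsLambda {n} G k =
  (Σ (Subset n) λ S → IsLDSet G S × ∣ S ∣ ≡ k) ×
  (∀ S → IsLDSet G S → k ≤ ∣ S ∣)

IsLDCode : ∀ {n} → SimpleGraph n → Subset n → Set
IsLDCode G S = IsLDSet G S × IsLambda G ∣ S ∣

record Graph (V : Set) : Set₁ where
  field
    Vtx : V → Set
    Adj : V → V → Set
open Graph public

data Walk {V : Set} (G : Graph V) : V → V → Set where
  here : ∀ {x} → Vtx G x → Walk G x x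
  step : ∀ {x y z} → Vtx G x → Adj G x y → Walk G y z → Walk G x z

Connected : ∀ {V} → Graph V → Set
Connected G = ∀ x y → Vtx G x → Vtx G y → Walk G x y

next : ∀ {k} → Fin (suc k) → Fin (suc k)
next {zero} zero = zero
next {suc k} zero = suc zero
next {suc k} (suc i) with next {k} i
... | zero  = zero
... | suc j = suc (suc j)

record Cycle {V : Set} (G : Graph V) : Set where
  field
    m      : ℕ
    c      : Fin (3 + m) → V
    inj    : ∀ i j → c i ≡ c j → i ≡ j
    inV    : ∀ i → Vtx G (c i)
    adj    : ∀ i → Adj G (c i) (c (next i))
open Cycle public

EdgeOn : ∀ {V} {G : Graph V} → Cycle G → V → V → Set
EdgeOn C a b = ∃ λ i → (c C i ≡ a × c C (next i) ≡ b) ⊎ (c C i ≡ b × c C (next i) ≡ a)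

SameCycle : ∀ {V} {G : Graph V} → Cycle G → Cycle G → Set
SameCycle {V} C D = ∀ (x y : V) → (EdgeOn C x y → EdgeOn D x y) × (EdgeOn D x y → EdgeOn C x y)

IsCactus : ∀ {V} → Graph V → Set
IsCactus {V} G = Connected G ×
  (∀ (C D : Cycle G) (a b : V) → EdgeOn C a b → EdgeOn D a b → SameCycle C D)

component : ∀ {V} → Graph V → V → Graph V
component G x = record { Vtx = λ y → Vtx G y × Walk G x y ; Adj = Adj G }

-- The S-associated graph G^S; vertices: nothing = new vertex z,
-- just v for v ∈ V ∖ S.

NS : ∀ {n} → SimpleGraph n → Maybe (Fin n) → Fin n → Set
NS G nothing  s = ⊥
NS G (just v) s = Adj G v s

VtxAssoc : ∀ {n} → Subset n → Maybe (Fin n) → Set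
VtxAssoc S nothing  = ⊤
VtxAssoc S (just v) = v ∉ S

InSymDiff : ∀ {n} → SimpleGraph n → Maybe (Fin n) → Maybe (Fin n) → Fin n → Set
InSymDiff G x y s = (NS G x s × ¬ NS G y s) ⊎ (NS G y s × ¬ NS G x s)

LabelledEdge : ∀ {n} → SimpleGraph n → Subset n → Maybe (Fin n) → Maybe (Fin n) → Fin n → Set
LabelledEdge G S x y u =
  VtxAssoc S x × VtxAssoc S y × u ∈ S × InSymDiff G x y u ×
  (∀ s → s ∈ S → InSymDiff G x y s → s ≡ u)

SamePair : {A : Set} → A → A → A → A → Set
SamePair a b c d = (a ≡ c × b ≡ d) ⊎ (a ≡ d × b ≡ c)

-- F (a symmetric relation = set of edges) is a set of edges of G^S
-- containing exactly two edges with label u for each u ∈ S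
TwoEdgesPerLabel : ∀ {n} → SimpleGraph n → Subset n → (Maybe (Fin n) → Maybe (Fin n) → Set) → Set
TwoEdgesPerLabel {n} G S F =
  (∀ x y → F x y → F y x) ×
  (∀ x y → F x y → ∃ λ u → LabelledEdge G S x y u) ×
  (∀ u → u ∈ S → ∃ λ a → ∃ λ b → ∃ λ c → ∃ λ d →
      F a b × LabelledEdge G S a b u × F c d × LabelledEdge G S c d u ×
      ¬ SamePair a b c d ×
      (∀ x y → F x y → LabelledEdge G S x y u → SamePair x y a b ⊎ SamePair x y c d))

edgeInduced : ∀ {A : Set} → (A → A → Set) → Graph A
edgeInduced F = record { Vtx = λ x → ∃ λ y → F x y ; Adj = F }

asGraph : ∀ {n} → SimpleGraph n → Graph (Fin n)
asGraph G = record { Vtx = λ _ → ⊤ ; Adj = Adj G }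

module Submission where

-- Only two hypotheses matter: U is an LD-set, and F consists of
-- edges of the associated graph G^U with at most two edges per label.  Let
-- t(x) be the trace N(x) ∩ U of a vertex x of G^U: along an edge with label u
-- it changes exactly at u, and distinct vertices have distinct traces.
--  (1) Going once around a cycle C of H the trace returns, so each label of C
--      occurs twice on C; hence every edge of F with a label of C lies on C.
--  (2) Let cycles C, D share an edge.  Were some label of C not a label of D,
--      there would be an arc of C from p to q whose labels all avoid D,
--      bounded by edges with labels of D; by (1) these lie on D, so p, q are
--      on D.  Then t(p), t(q) can differ only at labels of the arc (walk along
--      C) and at labels of D (walk along D), so t(p) = t(q) and p = q, which
--      is impossible on a cycle.  So all edges of C lie on D, and conversely.

open import Defs
open import Data.Nat using (ℕ; zero; suc; _+_; _∸_; _≤_; _<_; _<?_; z≤n; s≤s)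
open import Data.Nat.Properties
  using (<-irrefl; <⇒≤; ≤-trans; <-≤-trans; ≮⇒≥; m<m+n; m≤n+m; +-suc;
         +-comm; +-identityʳ; +-cancelˡ-≡; m+[n∸m]≡n; m∸n+n≡m; m+n∸m≡n; ∸-monoˡ-<;
         +-monoˡ-<; m<n⇒m<1+n; n<1+n; n≢0⇒n>0)
open import Data.Nat.DivMod
  using (_%_; _mod_; m%n<n; m<n⇒m%n≡m; n%n≡0; m%n%n≡m%n; [m+n]%n≡m%n;
         %-distribˡ-+; m≤n⇒[n∸m]%m≡n%m)
open import Data.Fin using (Fin; zero; suc; toℕ) renaming (_≟_ to _≟ᶠ_)
open import Data.Fin.Properties using (toℕ-injective; toℕ-fromℕ<; toℕ<n; any?)
open import Data.Fin.Subset using (Subset; _∈_; _∉_; ∣_∣; ∁)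
open import Data.Maybe using (Maybe; just; nothing)
open import Data.Bool using (Bool) renaming (_≟_ to _≟ᵇ_)
open import Data.Product using (∃; _×_; _,_; proj₁; proj₂)
open import Data.Sum using (_⊎_; inj₁; inj₂; swap)
open import Data.Empty using (⊥; ⊥-elim)
open import Relation.Nullary using (¬_; Dec; yes; no; does)
open import Relation.Nullary.Decidable using (dec-true; dec-false)
open import Relation.Unary using (Decidable)
open import Relation.Binary.PropositionalEquality
  using (_≡_; _≢_; refl; cong; subst; subst₂; trans; module ≡-Reasoning)
  renaming (sym to ≡-sym)

-- Cyclic positions.  A cycle of length L = suc K is traversed by the
-- positions 0, 1, 2, … ∈ ℕ; position a is the vertex with index a mod L.

next-cases : ∀ {K} (i : Fin (suc K)) →
  (toℕ i ≡ K × toℕ (next i) ≡ 0) ⊎ (toℕ i < K × toℕ (next i) ≡ suc (toℕ i))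
next-cases {zero}  zero    = inj₁ (refl , refl)
next-cases {suc K} zero    = inj₂ (s≤s z≤n , refl)
next-cases {suc K} (suc i) with next {K} i | next-cases {K} i
... | zero  | inj₁ (last , _) = inj₁ (cong suc last , refl)
... | suc j | inj₂ (lt , eq)  = inj₂ (s≤s lt , cong suc eq)

module Positions (K : ℕ) where

  L : ℕ
  L = suc K

  pos : ℕ → Fin L
  pos a = a mod L

  toℕ-pos : ∀ a → toℕ (pos a) ≡ a % L
  toℕ-pos a = toℕ-fromℕ< (m%n<n a L)

  pos-cong : ∀ a b → a % L ≡ b % L → pos a ≡ pos b
  pos-cong a b eq = toℕ-injective (trans (toℕ-pos a) (trans eq (≡-sym (toℕ-pos b))))

  pos-toℕ : ∀ (i : Fin L) → pos (toℕ i) ≡ i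
  pos-toℕ i = toℕ-injective (trans (toℕ-pos (toℕ i)) (m<n⇒m%n≡m (toℕ<n i)))

  pos-period : ∀ a → pos (a + L) ≡ pos a
  pos-period a = pos-cong (a + L) a ([m+n]%n≡m%n a L)

  toℕ-next : ∀ (i : Fin L) → toℕ (next i) ≡ suc (toℕ i) % L
  toℕ-next i with next-cases i
  ... | inj₁ (last , wrap) = trans wrap (≡-sym (trans (cong (λ j → suc j % L) last) (n%n≡0 L)))
  ... | inj₂ (lt , succ)   = trans succ (≡-sym (m<n⇒m%n≡m (s≤s lt)))

  pos-suc : ∀ a → next (pos a) ≡ pos (suc a)
  pos-suc a = toℕ-injective (begin
    toℕ (next (pos a))             ≡⟨ toℕ-next (pos a) ⟩
    suc (toℕ (pos a)) % L          ≡⟨ cong (λ r → suc r % L) (toℕ-pos a) ⟩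
    (1 + a % L) % L                ≡⟨ %-distribˡ-+ 1 (a % L) L ⟩
    (1 % L + a % L % L) % L        ≡⟨ cong (λ r → (1 % L + r) % L) (m%n%n≡m%n a L) ⟩
    (1 % L + a % L) % L            ≡⟨ ≡-sym (%-distribˡ-+ 1 a L) ⟩
    suc a % L                      ≡⟨ ≡-sym (toℕ-pos (suc a)) ⟩
    toℕ (pos (suc a))              ∎)
    where open ≡-Reasoning

  shift-moves : ∀ r d → r < L → 0 < d → d < L → r ≢ (r + d) % L
  shift-moves r d r<L 0<d d<L r≡ with r + d <? L
  ... | yes lt = <-irrefl (trans r≡ (m<n⇒m%n≡m lt)) (m<m+n r 0<d)
  ... | no ge  = <-irrefl d≡L d<L
    where
    L≤r+d : L ≤ r + d
    L≤r+d = ≮⇒≥ ge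
    e<L : r + d ∸ L < L
    e<L = <-≤-trans (∸-monoˡ-< (+-monoˡ-< d r<L) L≤r+d)
                    (subst (_≤ L) (≡-sym (m+n∸m≡n L d)) (<⇒≤ d<L))
    r≡e : r ≡ r + d ∸ L
    r≡e = trans r≡ (trans (≡-sym (m≤n⇒[n∸m]%m≡n%m L≤r+d)) (m<n⇒m%n≡m e<L))
    d≡L : d ≡ L
    d≡L = +-cancelˡ-≡ r d L (trans (≡-sym (m∸n+n≡m L≤r+d)) (cong (_+ L) (≡-sym r≡e)))

  pos-distinct : ∀ a d → 0 < d → d < L → pos a ≢ pos (a + d)
  pos-distinct a d 0<d d<L eq = shift-moves (a % L) d (m%n<n a L) 0<d d<L (begin
    a % L                  ≡⟨ ≡-sym (toℕ-pos a) ⟩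
    toℕ (pos a)            ≡⟨ cong toℕ eq ⟩
    toℕ (pos (a + d))      ≡⟨ toℕ-pos (a + d) ⟩
    (a + d) % L            ≡⟨ %-distribˡ-+ a d L ⟩
    (a % L + d % L) % L    ≡⟨ cong (λ x → (a % L + x) % L) (m<n⇒m%n≡m d<L) ⟩
    (a % L + d) % L        ∎)
    where open ≡-Reasoning

  next-pos : ∀ (i : Fin L) → next i ≡ pos (suc (toℕ i))
  next-pos i = trans (cong next (≡-sym (pos-toℕ i))) (pos-suc (toℕ i))

  two-steps-move : 2 < L → ∀ (i : Fin L) → next (next i) ≢ i
  two-steps-move 2<L i eq = pos-distinct (toℕ i) 2 (s≤s z≤n) 2<L (begin
    pos (toℕ i)              ≡⟨ pos-toℕ i ⟩
    i                        ≡⟨ ≡-sym eq ⟩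
    next (next i)            ≡⟨ cong next (next-pos i) ⟩
    next (pos (suc (toℕ i))) ≡⟨ pos-suc (suc (toℕ i)) ⟩
    pos (2 + toℕ i)          ≡⟨ cong pos (+-comm 2 (toℕ i)) ⟩
    pos (toℕ i + 2)          ∎)
    where open ≡-Reasoning

  reach : ∀ (i j : Fin L) → ∃ λ d → pos (toℕ i + d) ≡ j
  reach i j = toℕ j + L ∸ toℕ i , (begin
    pos (toℕ i + (toℕ j + L ∸ toℕ i)) ≡⟨ cong pos (m+[n∸m]≡n i≤j+L) ⟩
    pos (toℕ j + L)                   ≡⟨ pos-period (toℕ j) ⟩
    pos (toℕ j)                       ≡⟨ pos-toℕ j ⟩
    j                                 ∎)
    where
    open ≡-Reasoning
    i≤j+L : toℕ i ≤ toℕ j + L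
    i≤j+L = ≤-trans (<⇒≤ (toℕ<n i)) (m≤n+m L (toℕ j))

changePoint : ∀ {P : ℕ → Set} → Decidable P → ∀ d → P 0 → ¬ P d →
  ∃ λ k → P k × ¬ P (suc k)
changePoint P? zero    p0 ¬pd = ⊥-elim (¬pd p0)
changePoint P? (suc d) p0 ¬pd with P? d
... | yes pd  = d , pd , ¬pd
... | no ¬pd′ = changePoint P? d p0 ¬pd′

leastWitness : ∀ {P : ℕ → Set} → Decidable P → ∀ N → P N →
  ∃ λ r → r ≤ N × P r × (∀ r′ → r′ < r → ¬ P r′)
leastWitness P? N pN with P? 0
... | yes p0 = 0 , z≤n , p0 , λ _ ()
leastWitness P? zero    pN | no ¬p0 = ⊥-elim (¬p0 pN)
leastWitness {P} P? (suc N) pN | no ¬p0 with leastWitness (λ r → P? (suc r)) N pN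
... | r , r≤N , pr , below = suc r , s≤s r≤N , pr , earlier
  where
  earlier : ∀ r′ → r′ < suc r → ¬ P r′
  earlier zero     _         = ¬p0
  earlier (suc r′) (s≤s r′<r) = below r′ r′<r

-- Connected components.  In a graph with symmetric adjacency in which
-- every edge has its endpoints as vertices, each component is connected:
-- join two of its vertices through the base vertex.

module ComponentWalks {V : Set} (G : Graph V)
  (adj-sym : ∀ {x y} → Adj G x y → Adj G y x)
  (adj-vtx : ∀ {x y} → Adj G x y → Vtx G x) where

  snoc : ∀ {a b d} → Walk G a b → Adj G b d → Walk G a d
  snoc (here v)     e′ = step v e′ (here (adj-vtx (adj-sym e′)))
  snoc (step v e w) e′ = step v e (snoc w e′)

  reverse : ∀ {a b} → Walk G a b → Walk G b a
  reverse (here v)     = here v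
  reverse (step v e w) = snoc (reverse w) (adj-sym e)

  _++ᵂ_ : ∀ {a b d} → Walk G a b → Walk G b d → Walk G a d
  here v     ++ᵂ w′ = w′
  step v e w ++ᵂ w′ = step v e (w ++ᵂ w′)

  inComponent : ∀ {x₀ a b} → Walk G x₀ a → Walk G a b → Walk (component G x₀) a b
  inComponent w₀ (here v)     = here (v , w₀)
  inComponent w₀ (step v e w) = step (v , w₀) e (inComponent (snoc w₀ e) w)

  componentConnected : ∀ x₀ → Connected (component G x₀)
  componentConnected x₀ y z (_ , w₀y) (_ , w₀z) = inComponent w₀y (reverse w₀y ++ᵂ w₀z)

samePair-sym : ∀ {A : Set} {a b c d : A} → SamePair a b c d → SamePair c d a b
samePair-sym (inj₁ (p , q)) = inj₁ (≡-sym p , ≡-sym q)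
samePair-sym (inj₂ (p , q)) = inj₂ (≡-sym q , ≡-sym p)

samePair-trans : ∀ {A : Set} {a b c d e f : A} →
  SamePair a b c d → SamePair c d e f → SamePair a b e f
samePair-trans (inj₁ (p , q)) (inj₁ (r , s)) = inj₁ (trans p r , trans q s)
samePair-trans (inj₁ (p , q)) (inj₂ (r , s)) = inj₂ (trans p r , trans q s)
samePair-trans (inj₂ (p , q)) (inj₁ (r , s)) = inj₂ (trans p s , trans q r)
samePair-trans (inj₂ (p , q)) (inj₂ (r , s)) = inj₁ (trans p s , trans q r)

oneOfTwo : ∀ {A : Set} {x y e₁ e₂ e₁′ e₂′ a b c d : A} →
  SamePair e₁ e₂ a b ⊎ SamePair e₁ e₂ c d →
  SamePair e₁′ e₂′ a b ⊎ SamePair e₁′ e₂′ c d →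
  ¬ SamePair e₁ e₂ e₁′ e₂′ →
  SamePair x y a b ⊎ SamePair x y c d →
  SamePair x y e₁ e₂ ⊎ SamePair x y e₁′ e₂′
oneOfTwo (inj₁ p) (inj₁ q) ne _        = ⊥-elim (ne (samePair-trans p (samePair-sym q)))
oneOfTwo (inj₂ p) (inj₂ q) ne _        = ⊥-elim (ne (samePair-trans p (samePair-sym q)))
oneOfTwo (inj₁ p) (inj₂ q) ne (inj₁ r) = inj₁ (samePair-trans r (samePair-sym p))
oneOfTwo (inj₁ p) (inj₂ q) ne (inj₂ r) = inj₂ (samePair-trans r (samePair-sym q))
oneOfTwo (inj₂ p) (inj₁ q) ne (inj₁ r) = inj₂ (samePair-trans r (samePair-sym q))
oneOfTwo (inj₂ p) (inj₁ q) ne (inj₂ r) = inj₁ (samePair-trans r (samePair-sym p))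

module Traces {n} (G : SimpleGraph n) (S : Subset n) where

  NS? : ∀ x s → Dec (NS G x s)
  NS? nothing  s = no λ ()
  NS? (just v) s = dec G v s

  trace : Maybe (Fin n) → Fin n → Bool
  trace x s = does (NS? x s)

  differ⇒symDiff : ∀ {x y s} → trace x s ≢ trace y s → InSymDiff G x y s
  differ⇒symDiff {x} {y} {s} ne with NS? x s | NS? y s
  ... | yes a | no ¬b = inj₁ (a , ¬b)
  ... | no ¬a | yes b = inj₂ (b , ¬a)
  ... | yes _ | yes _ = ⊥-elim (ne refl)
  ... | no _  | no _  = ⊥-elim (ne refl)

  symDiff⇒differ : ∀ {x y s} → InSymDiff G x y s → trace x s ≢ trace y s
  symDiff⇒differ {x} {y} {s} (inj₁ (a , ¬b)) eq
    with trans (≡-sym (dec-true (NS? x s) a)) (trans eq (dec-false (NS? y s) ¬b))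
  ... | ()
  symDiff⇒differ {x} {y} {s} (inj₂ (b , ¬a)) eq
    with trans (≡-sym (dec-true (NS? y s) b)) (trans (≡-sym eq) (dec-false (NS? x s) ¬a))
  ... | ()

  label-flips : ∀ {x y u} → LabelledEdge G S x y u → trace x u ≢ trace y u
  label-flips {x} {y} {u} (_ , _ , _ , u∈Δ , _) = symDiff⇒differ {x} {y} {u} u∈Δ

  only-label-flips : ∀ {x y u s} → LabelledEdge G S x y u → s ∈ S →
    trace x s ≢ trace y s → s ≡ u
  only-label-flips {x} {y} {s = s} (_ , _ , _ , _ , unique) s∈S ne =
    unique s s∈S (differ⇒symDiff {x} {y} {s} ne)

  labelled-sym : ∀ {x y u} → LabelledEdge G S x y u → LabelledEdge G S y x u
  labelled-sym (x∈ , y∈ , u∈S , u∈Δ , unique) =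
    y∈ , x∈ , u∈S , swap u∈Δ , λ s s∈S s∈Δ → unique s s∈S (swap s∈Δ)

  label-unique : ∀ {x y u u′} → LabelledEdge G S x y u → LabelledEdge G S x y u′ → u ≡ u′
  label-unique (_ , _ , u∈S , u∈Δ , _) (_ , _ , _ , _ , unique) = unique _ u∈S u∈Δ

  same-trace⇒NS : ∀ {x y s} → trace x s ≡ trace y s → NS G x s → NS G y s
  same-trace⇒NS {x} {y} {s} eq xs with NS? y s
  ... | yes ys = ys
  ... | no ¬ys with trans (≡-sym (dec-true (NS? x s) xs)) eq
  ...   | ()

  -- for an LD-set S, distinct vertices of G^S have distinct traces on S:
  -- z has the empty trace, the others a nonempty one (domination), and two
  -- vertices outside S are separated by S (location)
  traces-separate : IsLDSet G S → ∀ p q → VtxAssoc S p → VtxAssoc S q →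
    (∀ s → s ∈ S → trace p s ≡ trace q s) → p ≡ q
  traces-separate ld nothing  nothing  _   _   same = refl
  traces-separate ld nothing  (just w) _   w∉S same with proj₁ ld w w∉S
  ... | s , s∈S , ws = ⊥-elim (same-trace⇒NS {just w} {nothing} (≡-sym (same s s∈S)) ws)
  traces-separate ld (just v) nothing  v∉S _   same with proj₁ ld v v∉S
  ... | s , s∈S , vs = ⊥-elim (same-trace⇒NS {just v} {nothing} (same s s∈S) vs)
  traces-separate ld (just v) (just w) v∉S w∉S same with v ≟ᶠ w
  ... | yes v≡w = cong just v≡w
  ... | no v≢w  = ⊥-elim (proj₂ ld v w v∉S w∉S v≢w λ s s∈S →
          same-trace⇒NS {just v} {just w} (same s s∈S) ,
          same-trace⇒NS {just w} {just v} (≡-sym (same s s∈S)))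

AtMostTwoPerLabel : ∀ {n} → SimpleGraph n → Subset n →
  (Maybe (Fin n) → Maybe (Fin n) → Set) → Set
AtMostTwoPerLabel G S F = ∀ u → u ∈ S → ∃ λ a → ∃ λ b → ∃ λ c → ∃ λ d →
  ∀ x y → F x y → LabelledEdge G S x y u → SamePair x y a b ⊎ SamePair x y c d

twoPerLabel⇒atMostTwo : ∀ {n} {G : SimpleGraph n} {S F} →
  TwoEdgesPerLabel G S F → AtMostTwoPerLabel G S F
twoPerLabel⇒atMostTwo (_ , _ , two) u u∈S with two u u∈S
... | a , b , c , d , _ , _ , _ , _ , _ , only = a , b , c , d , only

module CactusArgument {n} (G : SimpleGraph n) (S : Subset n) (ld : IsLDSet G S)
  (F : Maybe (Fin n) → Maybe (Fin n) → Set)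
  (F-labelled : ∀ x y → F x y → ∃ λ u → LabelledEdge G S x y u)
  (atMostTwo : AtMostTwoPerLabel G S F)
  (Γ : Graph (Maybe (Fin n))) (Γ⊆F : ∀ {x y} → Adj Γ x y → F x y) where

  open Traces G S

  OnCycle : Cycle Γ → Maybe (Fin n) → Set
  OnCycle C v = ∃ λ j → c C j ≡ v

  endpoints : ∀ {C : Cycle Γ} {x y} → EdgeOn C x y → OnCycle C x × OnCycle C y
  endpoints (i , inj₁ (p , q)) = (i , p) , (next i , q)
  endpoints (i , inj₂ (p , q)) = (next i , q) , (i , p)

  edgeOn-sym : ∀ {C : Cycle Γ} {x y} → EdgeOn C x y → EdgeOn C y x
  edgeOn-sym (i , inj₁ pq) = i , inj₂ pq
  edgeOn-sym (i , inj₂ pq) = i , inj₁ pq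

  module Around (C : Cycle Γ) where

    open Positions (2 + m C) public

    labelOf : Fin L → Fin n
    labelOf i = proj₁ (F-labelled _ _ (Γ⊆F (adj C i)))

    labelOf-edge : ∀ i → LabelledEdge G S (c C i) (c C (next i)) (labelOf i)
    labelOf-edge i = proj₂ (F-labelled _ _ (Γ⊆F (adj C i)))

    at : ℕ → Maybe (Fin n)
    at a = c C (pos a)

    label : ℕ → Fin n
    label a = labelOf (pos a)

    F-at : ∀ a → F (at a) (at (suc a))
    F-at a = subst (λ j → F (at a) (c C j)) (pos-suc a) (Γ⊆F (adj C (pos a)))

    labelled-at : ∀ a → LabelledEdge G S (at a) (at (suc a)) (label a)
    labelled-at a = subst (λ j → LabelledEdge G S (at a) (c C j) (label a)) (pos-suc a)
                          (labelOf-edge (pos a))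

    HasLabel : Fin n → Set
    HasLabel w = ∃ λ j → labelOf j ≡ w

    hasLabel? : Decidable HasLabel
    hasLabel? w = any? (λ j → labelOf j ≟ᶠ w)

    trace-changes-at-labels : ∀ s → s ∈ S → ∀ a d →
      trace (at a) s ≢ trace (at (a + d)) s → ∃ λ r → r < d × label (a + r) ≡ s
    trace-changes-at-labels s s∈S a zero ne =
      ⊥-elim (ne (cong (λ b → trace (at b) s) (≡-sym (+-identityʳ a))))
    trace-changes-at-labels s s∈S a (suc d) ne
      with trace (at (a + d)) s ≟ᵇ trace (at (a + suc d)) s
    ... | yes same with trace-changes-at-labels s s∈S a d (λ e → ne (trans e same))
    ...   | r , r<d , lab = r , m<n⇒m<1+n r<d , lab
    trace-changes-at-labels s s∈S a (suc d) ne | no flip =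
      d , n<1+n d , ≡-sym (only-label-flips (labelled-at (a + d)) s∈S
                      (subst (λ b → trace (at (a + d)) s ≢ trace (at b) s) (+-suc a d) flip))

    -- once around C the trace returns, so each label occurs on a second edge
    label-repeats : ∀ j → ∃ λ j′ → j′ ≢ j × labelOf j′ ≡ labelOf j
    label-repeats j = second-edge (trace-changes-at-labels w w∈S (suc k) K flips-back)
      where
      K = 2 + m C
      k = toℕ j
      w = labelOf j
      w∈S : w ∈ S
      w∈S = proj₁ (proj₂ (proj₂ (labelOf-edge j)))
      back : at (suc k + K) ≡ at k
      back = cong (c C) (trans (cong pos (≡-sym (+-suc k K))) (pos-period k))
      flips : trace (at k) w ≢ trace (at (suc k)) w
      flips = label-flips (subst (LabelledEdge G S (at k) (at (suc k)))
                                 (cong labelOf (pos-toℕ j)) (labelled-at k))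
      flips-back : trace (at (suc k)) w ≢ trace (at (suc k + K)) w
      flips-back e = flips (≡-sym (trans e (cong (λ v → trace v w) back)))
      second-edge : (∃ λ r → r < K × label (suc k + r) ≡ w) →
        ∃ λ j′ → j′ ≢ j × labelOf j′ ≡ w
      second-edge (r , r<K , lab) = pos (suc k + r) , moved , lab
        where
        moved : pos (suc k + r) ≢ j
        moved e = pos-distinct k (suc r) (s≤s z≤n) (s≤s r<K)
                    (trans (pos-toℕ j) (trans (≡-sym e) (cong pos (≡-sym (+-suc k r)))))

    -- different edges of C are different pairs (C has length at least 3)
    edges-distinct : ∀ i j → i ≢ j → ¬ SamePair (c C i) (c C (next i)) (c C j) (c C (next j))
    edges-distinct i j i≢j (inj₁ (same-start , _)) = i≢j (inj C i j same-start)
    edges-distinct i j i≢j (inj₂ (i↦nj , ni↦j)) =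
      two-steps-move (s≤s (s≤s (s≤s z≤n))) j
        (trans (cong next (≡-sym (inj C i (next j) i↦nj))) (inj C (next i) j ni↦j))

    samePair⇒edgeOn : ∀ {x y} i → SamePair x y (c C i) (c C (next i)) → EdgeOn C x y
    samePair⇒edgeOn i (inj₁ (p , q)) = i , inj₁ (≡-sym p , ≡-sym q)
    samePair⇒edgeOn i (inj₂ (p , q)) = i , inj₂ (≡-sym q , ≡-sym p)

    -- if w labels an edge of C, then every edge of F labelled w lies on C:
    -- C carries two different w-edges, and F has no others
    labelled-edge-on-cycle : ∀ {x y w} → F x y → LabelledEdge G S x y w → HasLabel w →
      EdgeOn C x y
    labelled-edge-on-cycle {x} {y} {w} xy xy-w (j , j-w) with label-repeats j
    ... | j′ , j′≢j , j′-j with atMostTwo w (proj₁ (proj₂ (proj₂ xy-w)))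
    ...   | _ , _ , _ , _ , only
      with oneOfTwo (only _ _ (Γ⊆F (adj C j)) (subst (LabelledEdge G S _ _) j-w (labelOf-edge j)))
                    (only _ _ (Γ⊆F (adj C j′))
                       (subst (LabelledEdge G S _ _) (trans j′-j j-w) (labelOf-edge j′)))
                    (edges-distinct j j′ (λ e → j′≢j (≡-sym e)))
                    (only x y xy xy-w)
    ...     | inj₁ on-j  = samePair⇒edgeOn j on-j
    ...     | inj₂ on-j′ = samePair⇒edgeOn j′ on-j′

    trace-differs-at-label : ∀ {p q s} → OnCycle C p → OnCycle C q → s ∈ S →
      trace p s ≢ trace q s → HasLabel s
    trace-differs-at-label {p} {q} {s} (jp , p-at) (jq , q-at) s∈S ne with reach jp jq
    ... | d , arrive with trace-changes-at-labels s s∈S (toℕ jp) d ne′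
      where
      ne′ : trace (at (toℕ jp)) s ≢ trace (at (toℕ jp + d)) s
      ne′ e = ne (begin
        trace p s                    ≡⟨ cong (λ v → trace v s) (≡-sym (trans (cong (c C) (pos-toℕ jp)) p-at)) ⟩
        trace (at (toℕ jp)) s        ≡⟨ e ⟩
        trace (at (toℕ jp + d)) s    ≡⟨ cong (λ v → trace v s) (trans (cong (c C) arrive) q-at) ⟩
        trace q s                    ∎)
        where open ≡-Reasoning
    ... | r , _ , lab = pos (toℕ jp + r) , lab

  module TwoCycles (C D : Cycle Γ) where
    module OnC = Around C
    module OnD = Around D
    open OnC using (at; label; L; pos; pos-distinct; pos-period)

    SharedIndex : Fin L → Set
    SharedIndex j = OnD.HasLabel (OnC.labelOf j)

    Shared : ℕ → Set
    Shared a = SharedIndex (pos a)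

    shared? : Decidable Shared
    shared? a = OnD.hasLabel? (label a)

    shared-edge-on-D : ∀ a → Shared a → EdgeOn D (at a) (at (suc a))
    shared-edge-on-D a = OnD.labelled-edge-on-cycle (OnC.F-at a) (OnC.labelled-at a)

    -- An arc of C from position a to a + r, with endpoints on D and no label
    -- of D on its edges, would join two vertices with equal traces.
    no-unshared-arc : ∀ a r → 0 < r → r < L →
      OnCycle D (at a) → OnCycle D (at (a + r)) → (∀ r′ → r′ < r → ¬ Shared (a + r′)) → ⊥
    no-unshared-arc a r 0<r r<L on-p on-q unshared =
      pos-distinct a r 0<r r<L (inj C (pos a) (pos (a + r)) p≡q)
      where
      same-traces : ∀ s → s ∈ S → trace (at a) s ≡ trace (at (a + r)) s
      same-traces s s∈S with trace (at a) s ≟ᵇ trace (at (a + r)) s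
      ... | yes same = same
      ... | no differ with OnC.trace-changes-at-labels s s∈S a r differ
      ...   | r′ , r′<r , lab =
              ⊥-elim (unshared r′ r′<r (subst OnD.HasLabel (≡-sym lab)
                        (OnD.trace-differs-at-label on-p on-q s∈S differ)))
      p≡q : at a ≡ at (a + r)
      p≡q = traces-separate ld (at a) (at (a + r))
              (proj₁ (OnC.labelled-at a)) (proj₁ (OnC.labelled-at (a + r))) same-traces

    -- A shared edge g followed by an unshared one starts such an arc: it runs
    -- up to the next shared edge, which exists as edge g itself comes round.
    no-shared-then-unshared : ∀ g → Shared g → ¬ Shared (suc g) → ⊥
    no-shared-then-unshared g shared-g unshared-next
      with leastWitness (λ r → shared? (suc g + r)) (2 + m C) shared-again
      where
      shared-again : Shared (suc g + (2 + m C))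
      shared-again = subst SharedIndex
        (≡-sym (trans (cong pos (≡-sym (+-suc g (2 + m C)))) (pos-period g))) shared-g
    ... | r , r≤K , shared-r , unshared-before =
      no-unshared-arc (suc g) r 0<r (s≤s r≤K)
        (proj₂ (endpoints {D} (shared-edge-on-D g shared-g)))
        (proj₁ (endpoints {D} (shared-edge-on-D (suc g + r) shared-r)))
        unshared-before
      where
      0<r : 0 < r
      0<r = n≢0⇒n>0 λ r≡0 → unshared-next
              (subst Shared (+-identityʳ (suc g)) (subst (λ x → Shared (suc g + x)) r≡0 shared-r))

    labels-shared : ∀ e → SharedIndex e → ∀ i → SharedIndex i
    labels-shared e shared-e i with OnD.hasLabel? (OnC.labelOf i)
    ... | yes shared-i = shared-i
    ... | no unshared-i with OnC.reach e i
    ...   | d , arrive with changePoint (λ k → shared? (toℕ e + k)) d start end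
      where
      start : Shared (toℕ e + 0)
      start = subst SharedIndex (≡-sym (trans (cong pos (+-identityʳ (toℕ e))) (OnC.pos-toℕ e))) shared-e
      end : ¬ Shared (toℕ e + d)
      end = subst (λ j → ¬ SharedIndex j) (≡-sym arrive) unshared-i
    ...     | k , shared-k , unshared-next =
              ⊥-elim (no-shared-then-unshared (toℕ e + k) shared-k
                        (subst (λ x → ¬ Shared x) (+-suc (toℕ e) k) unshared-next))

    edge-on-D : ∀ e → SharedIndex e → ∀ i → EdgeOn D (c C i) (c C (next i))
    edge-on-D e shared-e i =
      OnD.labelled-edge-on-cycle (Γ⊆F (adj C i)) (OnC.labelOf-edge i) (labels-shared e shared-e i)

    edges-shared : ∀ e → SharedIndex e → ∀ x y → EdgeOn C x y → EdgeOn D x y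
    edges-shared e shared-e x y (i , inj₁ (p , q)) = subst₂ (EdgeOn D) p q (edge-on-D e shared-e i)
    edges-shared e shared-e x y (i , inj₂ (p , q)) =
      edgeOn-sym {D} (subst₂ (EdgeOn D) p q (edge-on-D e shared-e i))

  edge-label : ∀ (C : Cycle Γ) {x y} → EdgeOn C x y →
    ∃ λ i → LabelledEdge G S x y (Around.labelOf C i)
  edge-label C (i , inj₁ (p , q)) =
    i , subst₂ (λ x y → LabelledEdge G S x y _) p q (Around.labelOf-edge C i)
  edge-label C (i , inj₂ (p , q)) =
    i , labelled-sym (subst₂ (λ x y → LabelledEdge G S x y _) p q (Around.labelOf-edge C i))

  cycles-sharing-an-edge-coincide : ∀ (C D : Cycle Γ) a b →
    EdgeOn C a b → EdgeOn D a b → SameCycle C D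
  cycles-sharing-an-edge-coincide C D a b on-C on-D with edge-label C on-C | edge-label D on-D
  ... | i , ab-i | j , ab-j = λ x y →
    TwoCycles.edges-shared C D i (j , ≡-sym same) x y ,
    TwoCycles.edges-shared D C j (i , same) x y
    where
    same : Around.labelOf C i ≡ Around.labelOf D j
    same = label-unique ab-i ab-j

lemma4p5 : ∀ {n} (G : SimpleGraph n) (U : Subset n) →
  Connected (asGraph G) →
  (∀ x y → x ∈ U → y ∈ U → ¬ Adj G x y) →
  (∀ x y → x ∉ U → y ∉ U → ¬ Adj G x y) →
  4 ≤ n → 3 ≤ ∣ U ∣ → ∣ U ∣ ≤ ∣ ∁ U ∣ →
  (∃ λ k → IsLambda G k × IsLambda (complement G) (k + 1)) →
  IsLDCode G U →
  (F : Maybe (Fin n) → Maybe (Fin n) → Set) →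
  TwoEdgesPerLabel G U F →
  ∀ x → Vtx (edgeInduced F) x → IsCactus (component (edgeInduced F) x)
lemma4p5 G U _ _ _ _ _ _ _ (U-LD , _) F two@(F-sym , F-labelled , _) x _ =
  ComponentWalks.componentConnected (edgeInduced F) (F-sym _ _) (λ {_} {b} ab → b , ab) x ,
  CactusArgument.cycles-sharing-an-edge-coincide G U U-LD F F-labelled
    (twoPerLabel⇒atMostTwo two) (component (edgeInduced F) x) (λ ab → ab)
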